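{- Let $\mathrel{|\!\sim}$ be a nonmonotonic consequence relation satisfying Loop, and let $\preceq=P_{tr}(\mathrel{|\!\sim})$, i.e. $\alpha\preceq\beta$ iff there exist $n\ge1$ and $\delta_1,\dots,\delta_n\in\mathcal{L}$ with $\neg\beta\mathrel{|\!\sim}\delta_1$, $\delta_1\mathrel{|\!\sim}\delta_2$, ..., $\delta_{n-1}\mathrel{|\!\sim}\delta_n$, $\delta_n\mathrel{|\!\sim}\neg\alpha$. Then $\preceq$ is an entrenchment relation satisfying Weak Left Disjunction and Transitivity such that for all $\alpha,\beta\in\mathcal{L}$, $\alpha\mathrel{|\!\sim}\beta$ iff $\alpha\mathrel{|\!\sim^w_\preceq}\beta$.
   Context: $\mathcal{L}$ is the set of formulas of a propositional language closed under $\lor,\land,\neg,\to$. $\vdash\subseteq 2^{\mathcal{L}}\times\mathcal{L}$ is a fixed consequence relation including classical propositional logic, compact, satisfying the deduction theorem and disjunction in premises; $\alpha\vdash\beta$ means $\{\alpha\}\vdash\beta$; $\mathrm{Cn}(X)=\{\beta:X\vdash\beta\}$. An entrenchment relation is a binary relation $\preceq$ on $\mathcal{L}$ such that for all $\alpha,\beta,\gamma$: $\alpha\preceq\alpha$; $\alpha\vdash\beta$ and $\beta\preceq\gamma$ imply $\alpha\preceq\gamma$; if $\alpha\vdash\beta$ and $\beta\vdash\alpha$ then $\gamma\preceq\alpha$ iff $\gamma\preceq\beta$. Weak Left Disjunction: $\alpha\lor\beta\preceq\alpha$, $\alpha\lor\gamma\preceq\alpha$ imply $\alpha\lor\beta\lor\gamma\preceq\alpha$.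 Transitivity: $\alpha\preceq\beta$, $\beta\preceq\gamma$ imply $\alpha\preceq\gamma$. $\mathrm{Coh}(\alpha)=\{\beta:\beta\not\preceq\neg\alpha\}$. Weak maxiconsistent inference: $U^\alpha=\{\alpha\to\beta:\beta\in U\}$; $\mathcal{B}^w(\alpha)$ = deductively closed $U$ ($U=\mathrm{Cn}(U)$) with $U^\alpha\subseteq\mathrm{Coh}(\alpha)$; $\mathcal{B}^w_{\max}(\alpha)$ = those $U\in\mathcal{B}^w(\alpha)$ such that no deductively closed $V\in\mathcal{B}^w(\alpha)$ has $U^\alpha\subsetneq V^\alpha$; $E^w(\alpha)=\bigcap\mathcal{B}^w_{\max}(\alpha)$ (empty intersection $=\mathcal{L}$); $\alpha\mathrel{|\!\sim^w_\preceq}\beta$ iff $\beta\in E^w(\alpha)$. A nonmonotonic consequence relation is a binary relation $\mathrel{|\!\sim}$ on $\mathcal{L}$ satisfying Supraclassicality ($\alpha\vdash\beta\Rightarrow\alpha\mathrel{|\!\sim}\beta$), Left Logical Equivalence ($\alpha\vdash\beta$, $\beta\vdash\alpha$, $\alpha\mathrel{|\!\sim}\gamma\Rightarrow\beta\mathrel{|\!\sim}\gamma$), Right Weakening ($\alpha\mathrel{|\!\sim}\beta$, $\beta\vdash\gamma\Rightarrow\alpha\mathrel{|\!\sim}\gamma$) and And ($\alpha\mathrel{|\!\sim}\beta$, $\alpha\mathrel{|\!\sim}\gamma\Rightarrow\alpha\mathrel{|\!\sim}\beta\land\gamma$). Loop: for all $n\ge1$, $\alpha_0\mathrel{|\!\sim}\alpha_1,\dots,\alpha_{n-1}\mathrel{|\!\sim}\alpha_n$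 and $\alpha_n\mathrel{|\!\sim}\alpha_0$ imply $\alpha_0\mathrel{|\!\sim}\alpha_n$. -}

module Defs where

open import Data.Bool using (Bool; true; false; _∧_; _∨_; not)
open import Data.Nat using (ℕ; zero; suc)
open import Data.Fin using (Fin; zero; suc; inject₁; fromℕ)
open import Data.List using (List)
open import Data.List.Membership.Propositional using (_∈_)
open import Data.Product using (Σ; ∃; _×_; _,_)
open import Relation.Nullary using (¬_)
open import Relation.Binary.PropositionalEquality using (_≡_)
open import Level using (0ℓ)
open import Relation.Unary using (Pred; _⊆_; _∪_; ｛_｝)

infixr 6 _∧'_
infixr 5 _∨'_
infixr 4 _⇒_

data Form (A : Set) : Set where
  atom : A → Form A
  ¬'_  : Form A → Form A
  _∧'_ : Form A → Form A → Form A
  _∨'_ : Form A → Form A → Form A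
  _⇒_  : Form A → Form A → Form A

-- Classical two-valued semantics (to express "⊢ includes classical
-- propositional logic").
⟦_⟧ : {A : Set} → Form A → (A → Bool) → Bool
⟦ atom p ⟧ v = v p
⟦ ¬' φ ⟧ v = not (⟦ φ ⟧ v)
⟦ φ ∧' ψ ⟧ v = ⟦ φ ⟧ v ∧ ⟦ ψ ⟧ v
⟦ φ ∨' ψ ⟧ v = ⟦ φ ⟧ v ∨ ⟦ ψ ⟧ v
⟦ φ ⇒ ψ ⟧ v = not (⟦ φ ⟧ v) ∨ ⟦ ψ ⟧ v

_⊨_ : {A : Set} → Pred (Form A) 0ℓ → Form A → Set
_⊨_ {A} X β = (v : A → Bool) → (∀ {φ} → X φ → ⟦ φ ⟧ v ≡ true) → ⟦ β ⟧ v ≡ true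

listSet : {A : Set} → List (Form A) → Pred (Form A) 0ℓ
listSet xs φ = φ ∈ xs

record ConsequenceRelation (A : Set) : Set₁ where
  field
    _⊢_ : Pred (Form A) 0ℓ → Form A → Set
    reflexivity  : ∀ {X β} → X β → X ⊢ β
    monotonicity : ∀ {X Y β} → X ⊆ Y → X ⊢ β → Y ⊢ β
    cut          : ∀ {X Y β} → (∀ {γ} → Y γ → X ⊢ γ) → (X ∪ Y) ⊢ β → X ⊢ β
    classical    : ∀ {X β} → X ⊨ β → X ⊢ β
    compact      : ∀ {X β} → X ⊢ β →
                   Σ (List (Form A)) λ xs → (listSet xs ⊆ X) × (listSet xs ⊢ β)
    deduction    : ∀ {X α β} → (X ∪ ｛ α ｝) ⊢ β → X ⊢ (α ⇒ β)
    deduction⁻¹  : ∀ {X α β} → X ⊢ (α ⇒ β) → (X ∪ ｛ α ｝) ⊢ β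
    disjPremises : ∀ {X α β γ} → (X ∪ ｛ α ｝) ⊢ γ → (X ∪ ｛ β ｝) ⊢ γ →
                   (X ∪ ｛ α ∨' β ｝) ⊢ γ

module _ {A : Set} (C : ConsequenceRelation A) where
  open ConsequenceRelation C

  _⊢₁_ : Form A → Form A → Set
  α ⊢₁ β = ｛ α ｝ ⊢ β

  record IsEntrenchment (_≼_ : Form A → Form A → Set) : Set where
    field
      refl≼    : ∀ α → α ≼ α
      domLeft  : ∀ α β γ → α ⊢₁ β → β ≼ γ → α ≼ γ
      eqRight  : ∀ α β γ → α ⊢₁ β → β ⊢₁ α → ((γ ≼ α → γ ≼ β) × (γ ≼ β → γ ≼ α))

  WeakLeftDisjunction : (Form A → Form A → Set) → Set
  WeakLeftDisjunction _≼_ = ∀ α β γ →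
    (α ∨' β) ≼ α → (α ∨' γ) ≼ α → ((α ∨' β) ∨' γ) ≼ α

  Transitivity : (Form A → Form A → Set) → Set
  Transitivity _≼_ = ∀ α β γ → α ≼ β → β ≼ γ → α ≼ γ

  module _ (_≼_ : Form A → Form A → Set) where

    Coh : Form A → Pred (Form A) 0ℓ
    Coh α β = ¬ (β ≼ (¬' α))

    _^_ : Pred (Form A) 0ℓ → Form A → Pred (Form A) 0ℓ
    (U ^ α) φ = Σ (Form A) λ β → U β × (φ ≡ (α ⇒ β))

    DedClosed : Pred (Form A) 0ℓ → Set
    DedClosed U = (∀ {β} → U ⊢ β → U β) × (∀ {β} → U β → U ⊢ β)

    Bw : Form A → Pred (Form A) 0ℓ → Set
    Bw α U = DedClosed U × ((U ^ α) ⊆ Coh α)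

    _⊊_ : Pred (Form A) 0ℓ → Pred (Form A) 0ℓ → Set
    X ⊊ Y = (X ⊆ Y) × ¬ (Y ⊆ X)

    BwMax : Form A → Pred (Form A) 0ℓ → Set₁
    BwMax α U = Bw α U ×
      ((V : Pred (Form A) 0ℓ) → DedClosed V → Bw α V → ¬ ((U ^ α) ⊊ (V ^ α)))

    -- E^w(α) = ⋂ B^w_max(α)   (empty intersection = ℒ)
    Ew : Form A → Pred (Form A) (Level.suc 0ℓ)
    Ew α β = (U : Pred (Form A) 0ℓ) → BwMax α U → U β

    _|~w_ : Form A → Form A → Set₁
    α |~w β = Ew α β

  record IsNMCR (_|~_ : Form A → Form A → Set) : Set where
    field
      supraclassicality : ∀ α β → α ⊢₁ β → α |~ β
      leftLogEq         : ∀ α β γ → α ⊢₁ β → β ⊢₁ α → α |~ γ → β |~ γ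
      rightWeakening    : ∀ α β γ → α |~ β → β ⊢₁ γ → α |~ γ
      and               : ∀ α β γ → α |~ β → α |~ γ → α |~ (β ∧' γ)

-- Loop: for n ≥ 1 (here n = suc m), a₀ |~ a₁, …, a_{n-1} |~ a_n and
-- a_n |~ a₀ imply a₀ |~ a_n.
Loop : {A : Set} → (Form A → Form A → Set) → Set
Loop {A} _|~_ = (m : ℕ) (a : Fin (suc (suc m)) → Form A) →
  ((i : Fin (suc m)) → a (inject₁ i) |~ a (suc i)) →
  a (fromℕ (suc m)) |~ a zero →
  a zero |~ a (fromℕ (suc m))

-- P_tr(|~): α ≼ β iff there are n ≥ 1 (n = suc m) and δ₁,…,δ_n with
-- ¬β |~ δ₁, δ₁ |~ δ₂, …, δ_{n-1} |~ δ_n, δ_n |~ ¬α.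
Ptr : {A : Set} → (Form A → Form A → Set) → Form A → Form A → Set
Ptr {A} _|~_ α β = Σ ℕ λ m → Σ (Fin (suc m) → Form A) λ δ →
  ((¬' β) |~ δ zero) ×
  ((i : Fin m) → δ (inject₁ i) |~ δ (suc i)) ×
  (δ (fromℕ m) |~ (¬' α))

{-# OPTIONS --safe #-}
module Submission where

-- P_tr(|~) orders formulas by |~-chains between their negations, i.e. it is the
-- transitive closure of ¬β |~ ¬α. Loop collapses such a chain to a single step
-- whenever the reverse step holds, so α → γ is incoherent with α exactly when
-- α |~ ¬γ. A |~-consequence β of α can therefore be added to any member of
-- B^w(α) without losing coherence, so it lies in every maximal one. Conversely,
-- for every valuation v satisfying {γ : α |~ γ} the theory of v is a maximal
-- member of B^w(α); a formula lying in all of them is thus classically entailed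
-- by {γ : α |~ γ}, which is deductively closed.

open import Defs
open import Data.Bool using (Bool; true; false; not)
open import Data.Bool.Properties using (not-involutive; ∧-conicalˡ; ∧-conicalʳ)
open import Data.Empty using (⊥; ⊥-elim)
open import Data.Fin using (Fin; zero; suc; inject₁; fromℕ)
open import Data.List using ([]; _∷_)
open import Data.List.Relation.Unary.Any using (here; there)
open import Data.Nat using (ℕ; zero; suc)
open import Data.Product using (Σ; _×_; _,_)
open import Data.Sum using (inj₁; inj₂)
open import Data.Vec.Functional as Vector using ()
open import Level using (0ℓ)
open import Relation.Binary.Construct.Closure.Transitive using (TransClosure; [_]; _∷_; _∷ʳ_; _++_)
open import Relation.Binary.PropositionalEquality using (_≡_; refl; sym; trans; cong; subst)
open import Relation.Nullary using (¬_)
open import Relation.Unary using (Pred; _⊆_; _∪_; ｛_｝; ∅)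

module Semantics {A : Set} where

  infix 3 _⊨₁_

  Th : (A → Bool) → Pred (Form A) 0ℓ
  Th v φ = ⟦ φ ⟧ v ≡ true

  _⊨₁_ : Form A → Form A → Set
  φ ⊨₁ ψ = ∀ v → Th v φ → Th v ψ

  module _ (φ ψ : Form A) where

    ⊨-mp : ∀ v → Th v φ → Th v (φ ⇒ ψ) → Th v ψ
    ⊨-mp v with ⟦ φ ⟧ v
    ... | true  = λ _ ψ-true → ψ-true
    ... | false = λ ()

    ⊨-mt : ∀ v → Th v (¬' ψ) → Th v (φ ⇒ ψ) → Th v (¬' φ)
    ⊨-mt v with ⟦ φ ⟧ v | ⟦ ψ ⟧ v
    ... | false | _     = λ _ _ → refl
    ... | true  | false = λ _ ()
    ... | true  | true  = λ ()

    ∧⇒⊨ : φ ∧' (φ ⇒ ψ) ⊨₁ ψ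
    ∧⇒⊨ v φ∧φ⇒ψ = ⊨-mp v (∧-conicalˡ _ _ φ∧φ⇒ψ) (∧-conicalʳ _ _ φ∧φ⇒ψ)

    ¬∨⊨¬ˡ : ¬' (φ ∨' ψ) ⊨₁ ¬' φ
    ¬∨⊨¬ˡ v with ⟦ φ ⟧ v
    ... | false = λ _ → refl
    ... | true  = λ ()

    ¬⇒⊨¬¬ : ¬' (φ ⇒ ψ) ⊨₁ ¬' ¬' φ
    ¬⇒⊨¬¬ v with ⟦ φ ⟧ v
    ... | true  = λ _ → refl
    ... | false = λ ()

    ¬⇒⊨¬ : ¬' (φ ⇒ ψ) ⊨₁ ¬' ψ
    ¬⇒⊨¬ v with ⟦ φ ⟧ v | ⟦ ψ ⟧ v
    ... | true  | false = λ _ → refl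
    ... | true  | true  = λ ()
    ... | false | _     = λ ()

    ∧¬⊨¬⇒ : φ ∧' ¬' ψ ⊨₁ ¬' (φ ⇒ ψ)
    ∧¬⊨¬⇒ v with ⟦ φ ⟧ v | ⟦ ψ ⟧ v
    ... | true  | false = λ _ → refl
    ... | true  | true  = λ ()
    ... | false | _     = λ ()

  ⊨-contradiction : ∀ φ v → Th v φ → Th v (¬' φ) → ⊥
  ⊨-contradiction φ v with ⟦ φ ⟧ v
  ... | true  = λ _ ()
  ... | false = λ ()

  ¬¬-intro : ∀ φ → φ ⊨₁ ¬' ¬' φ
  ¬¬-intro φ v φ-true = trans (not-involutive _) φ-true

  ¬¬-elim : ∀ φ → ¬' ¬' φ ⊨₁ φ
  ¬¬-elim φ v ¬¬φ-true = trans (sym (not-involutive _)) ¬¬φ-true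

  ¬∨∧¬∨⊨¬∨∨ : ∀ φ ψ χ → ¬' (φ ∨' ψ) ∧' ¬' (φ ∨' χ) ⊨₁ ¬' ((φ ∨' ψ) ∨' χ)
  ¬∨∧¬∨⊨¬∨∨ φ ψ χ v with ⟦ φ ⟧ v | ⟦ ψ ⟧ v | ⟦ χ ⟧ v
  ... | false | false | false = λ _ → refl
  ... | true  | _     | _     = λ ()
  ... | false | true  | _     = λ ()
  ... | false | false | true  = λ ()

module Classical {A : Set} (C : ConsequenceRelation A) where
  open ConsequenceRelation C
  open Semantics {A}

  Cn : Pred (Form A) 0ℓ → Pred (Form A) 0ℓ
  Cn X φ = X ⊢ φ

  ⊨₁⇒⊢₁ : ∀ {φ ψ} → φ ⊨₁ ψ → ｛ φ ｝ ⊢ ψ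
  ⊨₁⇒⊢₁ φ⊨ψ = classical (λ v sat → φ⊨ψ v (sat refl))

  Cn-⊢ : ∀ {X φ} → Cn X ⊢ φ → X ⊢ φ
  Cn-⊢ Cn⊢φ = cut (λ X⊢γ → X⊢γ) (monotonicity inj₂ Cn⊢φ)

  -- A valuation satisfying Cn X but not φ would refute ¬ ¬ (X ⊢ φ).
  ⊢-stable : ∀ {X φ} → ¬ ¬ (X ⊢ φ) → X ⊢ φ
  ⊢-stable {X} {φ} ¬¬X⊢φ = Cn-⊢ (classical Cn⊨φ)
    where
    Cn⊨φ : Cn X ⊨ φ
    Cn⊨φ v sat with ⟦ φ ⟧ v in φ-value
    ... | true  = refl
    ... | false = ⊥-elim (¬¬X⊢φ λ X⊢φ → ⊨-contradiction φ v (sat X⊢φ) (cong not φ-value))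

  contraposition : ∀ {φ ψ} → ｛ φ ｝ ⊢ ψ → ｛ ¬' ψ ｝ ⊢ (¬' φ)
  contraposition {φ} {ψ} φ⊢ψ =
    cut {Y = ｛ φ ⇒ ψ ｝} (λ { refl → ⊢φ⇒ψ })
      (classical λ v sat → ⊨-mt φ ψ v (sat (inj₁ refl)) (sat (inj₂ refl)))
    where
    ⊢φ⇒ψ : ｛ ¬' ψ ｝ ⊢ (φ ⇒ ψ)
    ⊢φ⇒ψ = monotonicity (λ ()) (deduction {X = ∅} (monotonicity inj₂ φ⊢ψ))

  ⊢-closed-if-mp-closed : {S : Pred (Form A) 0ℓ} →
    (∀ {φ} → ∅ ⊢ φ → S φ) → (∀ {φ ψ} → S φ → S (φ ⇒ ψ) → S ψ) →
    ∀ {φ} → S ⊢ φ → S φ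
  ⊢-closed-if-mp-closed {S} theorems mp S⊢φ with compact S⊢φ
  ... | xs , xs⊆S , xs⊢φ = from-list xs xs⊆S xs⊢φ
    where
    from-list : ∀ xs → listSet xs ⊆ S → ∀ {φ} → listSet xs ⊢ φ → S φ
    from-list [] _ ⊢φ = theorems (monotonicity (λ ()) ⊢φ)
    from-list (x ∷ xs) x∷xs⊆S x∷xs⊢φ =
      mp (x∷xs⊆S (here refl))
         (from-list xs (λ x∈xs → x∷xs⊆S (there x∈xs)) (deduction (monotonicity ∷⊆∪ x∷xs⊢φ)))
      where
      ∷⊆∪ : listSet (x ∷ xs) ⊆ listSet xs ∪ ｛ x ｝
      ∷⊆∪ (here φ≡x)   = inj₂ (sym φ≡x)
      ∷⊆∪ (there φ∈xs) = inj₁ φ∈xs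

module NonmonotonicConsequence {A : Set} (C : ConsequenceRelation A)
  (_|~_ : Form A → Form A → Set) (nmcr : IsNMCR C _|~_) where
  open ConsequenceRelation C
  open IsNMCR nmcr
  open Semantics {A}
  open Classical C

  P : Form A → Form A → Set
  P = Ptr _|~_

  _|~⁺_ : Form A → Form A → Set
  _|~⁺_ = TransClosure _|~_

  |~-refl : ∀ α → α |~ α
  |~-refl α = supraclassicality α α (reflexivity refl)

  |~-⊨ : ∀ {α β} → α ⊨₁ β → α |~ β
  |~-⊨ α⊨β = supraclassicality _ _ (⊨₁⇒⊢₁ α⊨β)

  |~-weaken-⊨ : ∀ {α β γ} → α |~ β → β ⊨₁ γ → α |~ γ
  |~-weaken-⊨ α|~β β⊨γ = rightWeakening _ _ _ α|~β (⊨₁⇒⊢₁ β⊨γ)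

  |~-¬¬ : ∀ {α β} → α |~ β → (¬' ¬' α) |~ β
  |~-¬¬ {α} = leftLogEq _ _ _ (⊨₁⇒⊢₁ (¬¬-intro α)) (⊨₁⇒⊢₁ (¬¬-elim α))

  ¬¬-|~ : ∀ {α β} → (¬' ¬' α) |~ β → α |~ β
  ¬¬-|~ {α} = leftLogEq _ _ _ (⊨₁⇒⊢₁ (¬¬-elim α)) (⊨₁⇒⊢₁ (¬¬-intro α))

  ⊢₁⇒¬|~¬ : ∀ {α β} → ｛ α ｝ ⊢ β → (¬' β) |~ (¬' α)
  ⊢₁⇒¬|~¬ α⊢β = supraclassicality _ _ (contraposition α⊢β)

  |~-closed : ∀ {α φ} → (α |~_) ⊢ φ → α |~ φ
  |~-closed = ⊢-closed-if-mp-closed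
    (λ ⊢φ → supraclassicality _ _ (monotonicity (λ ()) ⊢φ))
    (λ {φ} {ψ} α|~φ α|~φ⇒ψ → |~-weaken-⊨ (and _ _ _ α|~φ α|~φ⇒ψ) (∧⇒⊨ φ ψ))

  Chain : (m : ℕ) → (Fin (suc m) → Form A) → Set
  Chain m δ = (i : Fin m) → δ (inject₁ i) |~ δ (suc i)

  -- a |~ δ₀ |~ ⋯ |~ δₘ ≡ b, the shape of the premise of Loop.
  Walk : Form A → Form A → Set
  Walk a b = Σ ℕ λ m → Σ (Fin (suc m) → Form A) λ δ →
    Chain (suc m) (a Vector.∷ δ) × (δ (fromℕ m) ≡ b)

  ⁺⇒Walk : ∀ {a b} → a |~⁺ b → Walk a b
  ⁺⇒Walk {b = b} [ a|~b ] = 0 , (λ _ → b) , (λ { zero → a|~b }) , refl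
  ⁺⇒Walk (a|~c ∷ c|~⁺b) with ⁺⇒Walk c|~⁺b
  ... | m , δ , chain , δₘ≡b =
    suc m , (_ Vector.∷ δ) , (λ { zero → a|~c ; (suc i) → chain i }) , δₘ≡b

  chain⇒⁺ : ∀ m δ {b} → Chain m δ → δ (fromℕ m) |~ b → δ zero |~⁺ b
  chain⇒⁺ zero    δ _     δ₀|~b = [ δ₀|~b ]
  chain⇒⁺ (suc m) δ chain δₘ|~b =
    chain zero ∷ chain⇒⁺ m (λ i → δ (suc i)) (λ i → chain (suc i)) δₘ|~b

  Ptr⇒⁺ : ∀ {α β} → P α β → (¬' β) |~⁺ (¬' α)
  Ptr⇒⁺ (m , δ , ¬β|~δ₀ , chain , δₘ|~¬α) = ¬β|~δ₀ ∷ chain⇒⁺ m δ chain δₘ|~¬α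

  ⁺⇒Ptr : ∀ {α β} → (¬' β) |~⁺ (¬' α) → P α β
  ⁺⇒Ptr ¬β|~⁺¬α with ⁺⇒Walk ¬β|~⁺¬α
  ... | m , δ , chain , δₘ≡¬α =
    m , δ , chain zero , (λ i → chain (suc i)) , subst (δ (fromℕ m) |~_) δₘ≡¬α (|~-refl _)

  |~⇒Ptr : ∀ {α β} → (¬' β) |~ (¬' α) → P α β
  |~⇒Ptr ¬β|~¬α = ⁺⇒Ptr [ ¬β|~¬α ]

  Ptr-isEntrenchment : IsEntrenchment C P
  Ptr-isEntrenchment = record
    { refl≼   = λ α → |~⇒Ptr (|~-refl (¬' α))
    ; domLeft = λ α β γ α⊢β β≼γ → ⁺⇒Ptr (Ptr⇒⁺ β≼γ ∷ʳ ⊢₁⇒¬|~¬ α⊢β)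
    ; eqRight = λ α β γ α⊢β β⊢α →
        (λ γ≼α → ⁺⇒Ptr (⊢₁⇒¬|~¬ α⊢β ∷ Ptr⇒⁺ γ≼α)) ,
        (λ γ≼β → ⁺⇒Ptr (⊢₁⇒¬|~¬ β⊢α ∷ Ptr⇒⁺ γ≼β))
    }

  Ptr-transitive : Transitivity C P
  Ptr-transitive α β γ α≼β β≼γ = ⁺⇒Ptr (Ptr⇒⁺ β≼γ ++ Ptr⇒⁺ α≼β)

  |~¬⇒incoherent : ∀ {α γ} → α |~ (¬' γ) → P (α ⇒ γ) (¬' α)
  |~¬⇒incoherent {α} {γ} α|~¬γ =
    |~⇒Ptr (|~-¬¬ (|~-weaken-⊨ (and _ _ _ (|~-refl α) α|~¬γ) (∧¬⊨¬⇒ α γ)))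

  Coherent : Form A → Pred (Form A) 0ℓ → Set
  Coherent α U = ∀ {γ} → U γ → ¬ (α |~ (¬' γ))

  ^⊆Coh⇒Coherent : ∀ {α U} → _^_ C P U α ⊆ Coh C P α → Coherent α U
  ^⊆Coh⇒Coherent coh Uγ α|~¬γ = coh (_ , Uγ , refl) (|~¬⇒incoherent α|~¬γ)

  Cn-DedClosed : ∀ X → DedClosed C P (Cn X)
  Cn-DedClosed X = Cn-⊢ , reflexivity

  ∈^⇒∈ : ∀ {U α γ} → _^_ C P U α (α ⇒ γ) → U γ
  ∈^⇒∈ (_ , Uγ , refl) = Uγ

  Bw-consistent : ∀ {α V γ} → Bw C P α V → V γ → V (¬' γ) → ⊥
  Bw-consistent {α} {V} {γ} ((closed , _) , coh) Vγ V¬γ =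
    ^⊆Coh⇒Coherent coh V¬α (|~-⊨ (¬¬-intro α))
    where
    V¬α : V (¬' α)
    V¬α = closed (classical λ v sat → ⊥-elim (⊨-contradiction γ v (sat Vγ) (sat V¬γ)))

  module WithLoop (loop : Loop _|~_) where

    loop⁺ : ∀ {a b} → a |~⁺ b → b |~ a → a |~ b
    loop⁺ a|~⁺b b|~a with ⁺⇒Walk a|~⁺b
    ... | m , δ , chain , refl = loop m (_ Vector.∷ δ) chain b|~a

    Ptr⇒|~ : ∀ {α β} → P α β → (¬' α) |~ (¬' β) → (¬' β) |~ (¬' α)
    Ptr⇒|~ α≼β = loop⁺ (Ptr⇒⁺ α≼β)

    Ptr-weakLeftDisjunction : WeakLeftDisjunction C P
    Ptr-weakLeftDisjunction α β γ αβ≼α αγ≼α =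
      |~⇒Ptr (|~-weaken-⊨ (and _ _ _ (collapse β αβ≼α) (collapse γ αγ≼α)) (¬∨∧¬∨⊨¬∨∨ α β γ))
      where
      collapse : ∀ φ → P (α ∨' φ) α → (¬' α) |~ (¬' (α ∨' φ))
      collapse φ αφ≼α = Ptr⇒|~ αφ≼α (|~-⊨ (¬∨⊨¬ˡ α φ))

    incoherent⇒|~¬ : ∀ {α γ} → P (α ⇒ γ) (¬' α) → α |~ (¬' γ)
    incoherent⇒|~¬ {α} {γ} α⇒γ≼¬α =
      |~-weaken-⊨ (¬¬-|~ (Ptr⇒|~ α⇒γ≼¬α (|~-⊨ (¬⇒⊨¬¬ α γ)))) (¬⇒⊨¬ α γ)

    Coherent⇒^⊆Coh : ∀ {α U} → Coherent α U → _^_ C P U α ⊆ Coh C P α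
    Coherent⇒^⊆Coh coherent (_ , Uγ , refl) α⇒γ≼¬α = coherent Uγ (incoherent⇒|~¬ α⇒γ≼¬α)

    Bw-adjoin : ∀ {α β U} → α |~ β → Bw C P α U → Bw C P α (Cn (U ∪ ｛ β ｝))
    Bw-adjoin {α} {β} {U} α|~β ((closed , _) , coh) =
      Cn-DedClosed (U ∪ ｛ β ｝) , Coherent⇒^⊆Coh coherent
      where
      coherent : Coherent α (Cn (U ∪ ｛ β ｝))
      coherent {γ} U,β⊢γ α|~¬γ = ^⊆Coh⇒Coherent coh (closed (deduction U,β⊢γ))
        (|~-weaken-⊨ (and _ _ _ α|~β α|~¬γ) (∧¬⊨¬⇒ β γ))

    |~⇒|~w : ∀ {α β} → α |~ β → _|~w_ C P α β
    |~⇒|~w {α} {β} α|~β U (bw@((closed , derivable) , _) , maximal) =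
      closed (⊢-stable λ U⊬β → maximal _ (Cn-DedClosed _) (Bw-adjoin α|~β bw) (grows , proper U⊬β))
      where
      grows : _^_ C P U α ⊆ _^_ C P (Cn (U ∪ ｛ β ｝)) α
      grows (γ , Uγ , α⇒γ≡) = γ , reflexivity (inj₁ Uγ) , α⇒γ≡
      proper : ¬ (U ⊢ β) → ¬ (_^_ C P (Cn (U ∪ ｛ β ｝)) α ⊆ _^_ C P U α)
      proper U⊬β shrinks = U⊬β (derivable (∈^⇒∈ (shrinks (β , reflexivity (inj₂ refl) , refl))))

    Th-BwMax : ∀ {α v} → (α |~_) ⊆ Th v → BwMax C P α (Th v)
    Th-BwMax {α} {v} α|~⊆Th = (Th-DedClosed , Coherent⇒^⊆Coh Th-coherent) , Th-maximal
      where
      Th-DedClosed : DedClosed C P (Th v)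
      Th-DedClosed =
        ⊢-closed-if-mp-closed (λ ⊢φ → α|~⊆Th (|~-closed (monotonicity (λ ()) ⊢φ)))
                              (λ {φ} {ψ} → ⊨-mp φ ψ v) ,
        reflexivity
      Th-coherent : Coherent α (Th v)
      Th-coherent {γ} γ-true α|~¬γ = ⊨-contradiction γ v γ-true (α|~⊆Th α|~¬γ)
      -- A member of V false at v would put both it and its negation into V.
      Th-maximal : ∀ V → DedClosed C P V → Bw C P α V →
                   ¬ (_⊊_ C P (_^_ C P (Th v) α) (_^_ C P V α))
      Th-maximal V _ bwV (grows , ¬shrinks) = ¬shrinks λ { (γ , Vγ , refl) → γ , true-at-v Vγ , refl }
        where
        true-at-v : ∀ {γ} → V γ → Th v γ
        true-at-v {γ} Vγ with ⟦ γ ⟧ v in γ-value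
        ... | true  = refl
        ... | false = ⊥-elim (Bw-consistent bwV Vγ (∈^⇒∈ (grows (¬' γ , cong not γ-value , refl))))

    |~w⇒|~ : ∀ {α β} → _|~w_ C P α β → α |~ β
    |~w⇒|~ α|~wβ = |~-closed (classical λ v α|~⊆Th → α|~wβ (Th v) (Th-BwMax α|~⊆Th))

mainTheorem20 : {A : Set} (C : ConsequenceRelation A)
    (_|~_ : Form A → Form A → Set) →
    IsNMCR C _|~_ → Loop _|~_ →
    IsEntrenchment C (Ptr _|~_) ×
    WeakLeftDisjunction C (Ptr _|~_) ×
    Transitivity C (Ptr _|~_) ×
    ((α β : Form A) → ((α |~ β → _|~w_ C (Ptr _|~_) α β) × (_|~w_ C (Ptr _|~_) α β → α |~ β)))
mainTheorem20 C _|~_ nmcr loop =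
  Ptr-isEntrenchment , Ptr-weakLeftDisjunction , Ptr-transitive , λ α β → |~⇒|~w , |~w⇒|~
  where
  open NonmonotonicConsequence C _|~_ nmcr
  open WithLoop loop
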